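{- For every $n\ge 2$, the QBF $\textsc{EQ}'_n$ is false, and the universal strategy $\vec f$ given by $\vec f(\sigma)(u_i)=\sigma(x_i)$ for $1\le i\le n$ (for $\sigma$ an assignment of $x_1,\dots,x_n$) is the unique universal winning strategy for $\textsc{EQ}'_n$.
   Context: $\textsc{EQ}'_n := \exists x_1\ldots\exists x_n\forall u_1\ldots\forall u_n\exists t_1\ldots\exists t_n\exists e_1\ldots\exists e_n.\ \bigwedge_{i=1}^n\big((x_i\lor u_i\lor\neg t_i)\land(\neg x_i\lor\neg u_i\lor\neg t_i)\big)\land(t_1\lor e_1)\land\bigwedge_{i=2}^{n-1}(\neg e_{i-1}\lor t_i\lor e_i)\land(\neg e_{n-1}\lor t_n)$. A universal strategy assigns to each universal variable $u$ a function $f_u$ depending only on the variables left of $u$ in the prefix (here: on $x_1,\dots,x_n$); it is winning if for every assignment of the existential variables, combined with the values given by the $f_u$, the matrix is falsified. A QBF is false iff it has a universal winning strategy. -}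

module Defs where

open import Data.Bool using (Bool; true; false; _∧_; _∨_; not)
open import Data.Nat using (ℕ; zero; suc; _∸_; _<?_)
open import Data.Fin using (Fin; fromℕ<)
open import Data.List using (List; map; upTo)
open import Data.Bool.ListAction using (and)
open import Data.Product using (Σ)
open import Relation.Nullary using (¬_; yes; no)
open import Relation.Binary.PropositionalEquality using (_≡_)

Assignment : ℕ → Set
Assignment n = Fin n → Bool

-- Read the variable with 0-based index i (default false if out of range;
-- out-of-range indices are never read when n ≥ 2).
at : ∀ {n} → Assignment n → ℕ → Bool
at {n} v i with i <? n
... | yes p = v (fromℕ< p)
... | no  _ = false

-- The matrix of EQ'_n, with 0-based indices (x_i ↦ x (i-1), etc.):
--   ⋀_i (x_i ∨ u_i ∨ ¬t_i) ∧ (¬x_i ∨ ¬u_i ∨ ¬t_i)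
--   ∧ (t_1 ∨ e_1) ∧ ⋀_{i=2}^{n-1} (¬e_{i-1} ∨ t_i ∨ e_i) ∧ (¬e_{n-1} ∨ t_n)
matrix : (n : ℕ) → (x u t e : Assignment n) → Bool
matrix n x u t e =
  and (map (λ i → (at x i ∨ at u i ∨ not (at t i))
                ∧ (not (at x i) ∨ not (at u i) ∨ not (at t i))) (upTo n))
  ∧ (at t 0 ∨ at e 0)
  ∧ and (map (λ k → not (at e k) ∨ at t (suc k) ∨ at e (suc k)) (upTo (n ∸ 2)))
  ∧ (not (at e (n ∸ 2)) ∨ at t (n ∸ 1))

EQ'-true : ℕ → Set
EQ'-true n = Σ (Assignment n) λ x → (u : Assignment n) →
  Σ (Assignment n) λ t → Σ (Assignment n) λ e → matrix n x u t e ≡ true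

UStrategy : ℕ → Set
UStrategy n = Fin n → Assignment n → Bool

Winning : (n : ℕ) → UStrategy n → Set
Winning n f = (x t e : Assignment n) → matrix n x (λ i → f i x) t e ≡ false

copyStrategy : (n : ℕ) → UStrategy n
copyStrategy n i σ = σ i

{-# OPTIONS --safe #-}
module Submission where

-- If u = x, the pair of clauses for each i forces t_i false; then t_1 ∨ e_1 forces e_1, the
-- clauses ¬e_(i-1) ∨ t_i ∨ e_i pass e along, and ¬e_(n-1) ∨ t_n fails. So copying wins and
-- EQ'_n is false. If instead u_i ≠ x_i for some i, the existential player sets t_i as the
-- only true t and e_k true exactly for k < i: the pair of clauses for i holds because
-- x_i ≠ u_i, all others because their t is false, and t_i takes over where e stops.

open import Defs
open import Data.Bool using (Bool; true; false; _∧_; _∨_; not; T)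
open import Data.Bool.Properties using (T-∧)
import Data.Bool.Properties as Bool
open import Data.Bool.ListAction using (and; all)
open import Data.Empty using (⊥-elim)
open import Data.Fin using (Fin; toℕ)
open import Data.Fin.Properties using (toℕ<n; toℕ-fromℕ<; fromℕ<-toℕ)
open import Data.List using (upTo)
open import Data.List.Properties using (map-cong)
import Data.List.Relation.Unary.All as All
open import Data.List.Relation.Unary.All.Properties using (all⁺; all⁻)
open import Data.List.Membership.Propositional.Properties using (∈-upTo⁺; ∈-upTo⁻)
open import Data.Nat using (ℕ; zero; suc; _≤_; _<_; z≤n; s≤s; _<?_; _<ᵇ_; _≡ᵇ_; _≟_)
open import Data.Nat.Properties using (≤-refl; <⇒≤; m≤n⇒m≤1+n; <-trans; ≡ᵇ⇒≡; <ᵇ⇒<)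
open import Data.Product using (_×_; _,_; proj₁; proj₂)
open import Function using (_∘_; Equivalence)
open import Relation.Nullary using (¬_; yes; no)
open import Relation.Binary.PropositionalEquality using (_≡_; _≢_; _≗_; refl; sym; trans; cong; cong₂; subst)

open Equivalence using (to; from)

¬T⇒≡false : ∀ {b} → ¬ T b → b ≡ false
¬T⇒≡false {false} _  = refl
¬T⇒≡false {true}  ¬t = ⊥-elim (¬t _)

∨-resolveˡ : ∀ {a b} → T (a ∨ b) → ¬ T a → T b
∨-resolveˡ {true}  _ ¬a = ⊥-elim (¬a _)
∨-resolveˡ {false} b _  = b

→-elim : ∀ {a b} → T (not a ∨ b) → T a → T b
→-elim {true} b _ = b

all-upTo⁻ : ∀ (p : ℕ → Bool) {n} → T (all p (upTo n)) → ∀ {k} → k < n → T (p k)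
all-upTo⁻ p {n} ps k<n = All.lookup (all⁺ p (upTo n) ps) (∈-upTo⁺ k<n)

all-upTo⁺ : ∀ (p : ℕ → Bool) {n} → (∀ {k} → k < n → T (p k)) → T (all p (upTo n))
all-upTo⁺ p ps = all⁻ p (All.tabulate (ps ∘ ∈-upTo⁻))

at-toℕ : ∀ {n} (v : Assignment n) (j : Fin n) → at v (toℕ j) ≡ v j
at-toℕ {n} v j with toℕ j <? n
... | yes j<n = cong v (fromℕ<-toℕ j j<n)
... | no  j≮n = ⊥-elim (j≮n (toℕ<n j))

at-∘toℕ : ∀ {n} (g : ℕ → Bool) → (∀ k → T (g k) → k < n) → at {n} (g ∘ toℕ) ≗ g
at-∘toℕ {n} g supported k with k <? n
... | yes k<n = cong g (toℕ-fromℕ< k<n)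
... | no  k≮n = sym (¬T⇒≡false (k≮n ∘ supported k))

pairClause : Bool → Bool → Bool → Bool
pairClause a b c = (a ∨ b ∨ not c) ∧ (not a ∨ not b ∨ not c)

pairClause-diagonal : ∀ a c → T (pairClause a a c) → ¬ T c
pairClause-diagonal true  true  ()
pairClause-diagonal false true  ()

pairClause-≢ : ∀ {a b} c → a ≢ b → T (pairClause a b c)
pairClause-≢ {true}  {true}  _ a≢b = ⊥-elim (a≢b refl)
pairClause-≢ {true}  {false} _ _   = _
pairClause-≢ {false} {true}  _ _   = _
pairClause-≢ {false} {false} _ a≢b = ⊥-elim (a≢b refl)

pairClause-¬T : ∀ a b {c} → ¬ T c → T (pairClause a b c)
pairClause-¬T _     _     {true}  ¬c = ⊥-elim (¬c _)
pairClause-¬T true  true  {false} _  = _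
pairClause-¬T true  false {false} _  = _
pairClause-¬T false true  {false} _  = _
pairClause-¬T false false {false} _  = _

pairClauses : (n : ℕ) (x u t : Assignment n) → Bool
pairClauses n x u t = all (λ i → pairClause (at x i) (at u i) (at t i)) (upTo n)

-- matrix (2 + m) x u t e unfolds definitionally to pairClauses (2 + m) x u t ∧ chain m (at t) (at e).
chain : ℕ → (t e : ℕ → Bool) → Bool
chain m t e =
  (t 0 ∨ e 0)
  ∧ all (λ k → not (e k) ∨ t (suc k) ∨ e (suc k)) (upTo m)
  ∧ (not (e m) ∨ t (suc m))

chain-unsatisfiable : ∀ m {t e : ℕ → Bool} → (∀ k → k ≤ suc m → ¬ T (t k)) → ¬ T (chain m t e)
chain-unsatisfiable m {t} {e} t-false sat = t-false (suc m) ≤-refl (→-elim last (e-true m ≤-refl))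
  where
  step : ℕ → Bool
  step k = not (e k) ∨ t (suc k) ∨ e (suc k)
  first : T (t 0 ∨ e 0)
  first = proj₁ (to (T-∧ {t 0 ∨ e 0}) sat)
  rest : T (all step (upTo m) ∧ (not (e m) ∨ t (suc m)))
  rest = proj₂ (to (T-∧ {t 0 ∨ e 0}) sat)
  steps : T (all step (upTo m))
  steps = proj₁ (to (T-∧ {all step (upTo m)}) rest)
  last : T (not (e m) ∨ t (suc m))
  last = proj₂ (to (T-∧ {all step (upTo m)}) rest)
  e-true : ∀ k → k ≤ m → T (e k)
  e-true zero    _   = ∨-resolveˡ first (t-false 0 z≤n)
  e-true (suc k) k<m = ∨-resolveˡ
    (→-elim (all-upTo⁻ step steps k<m) (e-true k (<⇒≤ k<m)))
    (t-false (suc k) (m≤n⇒m≤1+n k<m))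

chain-cong : ∀ m {t t′ e e′ : ℕ → Bool} → t ≗ t′ → e ≗ e′ → chain m t e ≡ chain m t′ e′
chain-cong m {t} {t′} {e} {e′} t≗t′ e≗e′ =
  cong₂ _∧_ (cong₂ _∨_ (t≗t′ 0) (e≗e′ 0))
    (cong₂ _∧_ (cong and (map-cong step≗step′ (upTo m)))
               (cong₂ _∨_ (cong not (e≗e′ m)) (t≗t′ (suc m))))
  where
  step≗step′ : ∀ k → (not (e k) ∨ t (suc k) ∨ e (suc k)) ≡ (not (e′ k) ∨ t′ (suc k) ∨ e′ (suc k))
  step≗step′ k = cong₂ _∨_ (cong not (e≗e′ k)) (cong₂ _∨_ (t≗t′ (suc k)) (e≗e′ (suc k)))

chain-≡ᵇ-<ᵇ : ∀ m {I} → I < suc (suc m) → T (chain m (_≡ᵇ I) (_<ᵇ I))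
chain-≡ᵇ-<ᵇ m {I} I<2+m =
  from T-∧ (start I , from T-∧ (all-upTo⁺ _ {m} (λ {k} _ → step k I) , end m I<2+m))
  where
  start : ∀ I → T ((0 ≡ᵇ I) ∨ (0 <ᵇ I))
  start zero    = _
  start (suc _) = _
  step : ∀ k I → T (not (k <ᵇ I) ∨ (suc k ≡ᵇ I) ∨ (suc k <ᵇ I))
  step zero    zero          = _
  step zero    (suc zero)    = _
  step zero    (suc (suc _)) = _
  step (suc _) zero          = _
  step (suc k) (suc I)       = step k I
  end : ∀ m {I} → I < suc (suc m) → T (not (m <ᵇ I) ∨ (suc m ≡ᵇ I))
  end zero    {zero}        _                = _
  end zero    {suc zero}    _                = _
  end zero    {suc (suc _)} (s≤s (s≤s ()))
  end (suc m) {zero}        _                = _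
  end (suc m) {suc I}       (s≤s I<2+m)      = end m I<2+m

matrix-diagonal-false : ∀ m (x t e : Assignment (suc (suc m))) →
  matrix (suc (suc m)) x x t e ≡ false
matrix-diagonal-false m x t e = ¬T⇒≡false λ sat →
  let pairs , chained = to (T-∧ {pairClauses (suc (suc m)) x x t}) sat
      t-false : ∀ k → k ≤ suc m → ¬ T (at t k)
      t-false k k≤1+m = pairClause-diagonal (at x k) (at t k)
        (all-upTo⁻ (λ i → pairClause (at x i) (at x i) (at t i)) pairs (s≤s k≤1+m))
  in chain-unsatisfiable m {e = at e} t-false chained

onlyAt : ∀ {n} → Fin n → Assignment n
onlyAt i j = toℕ j ≡ᵇ toℕ i

before : ∀ {n} → Fin n → Assignment n
before i j = toℕ j <ᵇ toℕ i

at-onlyAt : ∀ {n} (i : Fin n) → at (onlyAt i) ≗ (_≡ᵇ toℕ i)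
at-onlyAt i = at-∘toℕ _ λ k k≡i → subst (_< _) (sym (≡ᵇ⇒≡ k (toℕ i) k≡i)) (toℕ<n i)

at-before : ∀ {n} (i : Fin n) → at (before i) ≗ (_<ᵇ toℕ i)
at-before i = at-∘toℕ _ λ k k<i → <-trans (<ᵇ⇒< k (toℕ i) k<i) (toℕ<n i)

matrix-deviation-satisfiable : ∀ m (x u : Assignment (suc (suc m))) (i : Fin (suc (suc m))) →
  u i ≢ x i → T (matrix (suc (suc m)) x u (onlyAt i) (before i))
matrix-deviation-satisfiable m x u i u≢x =
  from (T-∧ {pairClauses (suc (suc m)) x u (onlyAt i)})
    ( all-upTo⁺ _ {suc (suc m)} (λ {k} _ → pair k)
    , subst T (sym (chain-cong m (at-onlyAt i) (at-before i))) (chain-≡ᵇ-<ᵇ m (toℕ<n i)))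
  where
  pair : ∀ k → T (pairClause (at x k) (at u k) (at (onlyAt i) k))
  pair k with k ≟ toℕ i
  ... | yes refl rewrite at-toℕ x i | at-toℕ u i = pairClause-≢ _ (u≢x ∘ sym)
  ... | no  k≢i  = pairClause-¬T (at x k) (at u k)
                     (k≢i ∘ ≡ᵇ⇒≡ k (toℕ i) ∘ subst T (at-onlyAt i k))

lemma5 : (n : ℕ) → 2 ≤ n →
    ¬ EQ'-true n
    × Winning n (copyStrategy n)
    × ((f : UStrategy n) → Winning n f →
         (i : Fin n) (σ : Assignment n) → f i σ ≡ copyStrategy n i σ)
lemma5 (suc (suc m)) (s≤s (s≤s z≤n)) = not-true , matrix-diagonal-false m , copy-unique
  where
  not-true : ¬ EQ'-true (suc (suc m))
  not-true (x , wins)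
    with t , e , sat ← wins x
    with () ← trans (sym sat) (matrix-diagonal-false m x t e)
  copy-unique : (f : UStrategy (suc (suc m))) → Winning (suc (suc m)) f →
    (i : Fin (suc (suc m))) (σ : Assignment (suc (suc m))) → f i σ ≡ σ i
  copy-unique f winning i σ with f i σ Bool.≟ σ i
  ... | yes f≡σ = f≡σ
  ... | no  f≢σ = ⊥-elim (subst T (winning σ (onlyAt i) (before i))
                            (matrix-deviation-satisfiable m σ (λ j → f j σ) i f≢σ))
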